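{- Let $P$ be a property of graphs closed under c-minors (if a graph has $P$, every c-minor of it has $P$). Let $G$ be a finite simple graph containing no cycle of length $3$ and no cycle of length $5$, and let $B$ be a $2$-connected block of $G$. If $G$ has property $P$ and $B$ does not have property $P$, then there exists $x\in D_1(B)$ with $\deg_G(x)=1$.
   Context: A c-minor of $G$ is a graph of the form $G\setminus N_G[S]$ (induced subgraph on $V(G)\setminus N_G[S]$, where $N_G[S]$ is $S$ together with all neighbours of vertices of $S$) for some stable set $S$ of $G$. A block is a maximal subgraph without cut vertices; a graph is $2$-connected if it is connected, has at least three vertices and has no cut vertex. $D_1(B)$ is the set of vertices of $G$ at distance exactly $1$ from $V(B)$. -}

module Defs where

open import Data.Nat using (ℕ)
open import Data.Fin using (Fin)
open import Data.Bool using (Bool; true; false)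
open import Data.List using (length; filterᵇ; allFin)
open import Data.Product using (Σ; ∃; _×_; _,_)
open import Data.Sum using (_⊎_)
open import Relation.Nullary using (¬_)
open import Relation.Binary.PropositionalEquality using (_≡_; _≢_)

record Graph : Set where
  field
    n      : ℕ
    adj    : Fin n → Fin n → Bool
    sym    : ∀ u v → adj u v ≡ adj v u
    irrefl : ∀ v → adj v v ≡ false
open Graph public

VSet : Graph → Set₁
VSet G = Fin (n G) → Set

Adj : (G : Graph) → Fin (n G) → Fin (n G) → Set
Adj G u v = adj G u v ≡ true

deg : (G : Graph) → Fin (n G) → ℕ
deg G v = length (filterᵇ (adj G v) (allFin (n G)))

Stable : (G : Graph) → VSet G → Set
Stable G S = ∀ u v → S u → S v → ¬ Adj G u v

ClosedNbhd : (G : Graph) → VSet G → VSet G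
ClosedNbhd G S v = S v ⊎ ∃ λ u → S u × Adj G u v

InducedIso : (H G : Graph) → VSet G → Set
InducedIso H G U =
  Σ (Fin (n H) → Fin (n G)) λ f →
    (∀ i j → f i ≡ f j → i ≡ j) ×
    (∀ i → U (f i)) ×
    (∀ v → U v → ∃ λ i → f i ≡ v) ×
    (∀ i j → adj H i j ≡ adj G (f i) (f j))

IsCMinor : (H G : Graph) → Set
IsCMinor H G = ∃ λ (S : Fin (n G) → Bool) →
  Stable G (λ v → S v ≡ true) × InducedIso H G (λ v → ¬ ClosedNbhd G (λ v → S v ≡ true) v)

ClosedUnderCMinors : (Graph → Set) → Set
ClosedUnderCMinors P = ∀ G H → IsCMinor H G → P G → P H

data WalkIn (G : Graph) (U : VSet G) : Fin (n G) → Fin (n G) → Set where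
  here : ∀ {u} → U u → WalkIn G U u u
  step : ∀ {u w v} → U u → Adj G u w → WalkIn G U w v → WalkIn G U u v

ConnectedOn : (G : Graph) → VSet G → Set
ConnectedOn G U = ∀ u v → U u → U v → WalkIn G U u v

Remove : (G : Graph) → VSet G → Fin (n G) → VSet G
Remove G U x v = U v × v ≢ x

ConnNoCut : (G : Graph) → VSet G → Set
ConnNoCut G U = ConnectedOn G U × (∀ x → U x → ConnectedOn G (Remove G U x))

-- U is the vertex set of a block of G: a maximal connected subgraph without
-- cut vertices (blocks are induced subgraphs, so given by vertex sets)
IsBlock : (G : Graph) → VSet G → Set₁
IsBlock G U = ConnNoCut G U × (∀ W → (∀ v → U v → W v) → ConnNoCut G W → ∀ v → W v → U v)

AtLeastThree : (G : Graph) → VSet G → Set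
AtLeastThree G U = ∃ λ a → ∃ λ b → ∃ λ c →
  U a × U b × U c × a ≢ b × a ≢ c × b ≢ c

TwoConnected : (G : Graph) → VSet G → Set
TwoConnected G U = AtLeastThree G U × ConnNoCut G U

HasC3 : Graph → Set
HasC3 G = ∃ λ a → ∃ λ b → ∃ λ c →
  a ≢ b × a ≢ c × b ≢ c × Adj G a b × Adj G b c × Adj G c a

HasC5 : Graph → Set
HasC5 G = ∃ λ a → ∃ λ b → ∃ λ c → ∃ λ d → ∃ λ e →
  (a ≢ b × a ≢ c × a ≢ d × a ≢ e × b ≢ c × b ≢ d × b ≢ e × c ≢ d × c ≢ e × d ≢ e) ×
  Adj G a b × Adj G b c × Adj G c d × Adj G d e × Adj G e a

HasPOn : (Graph → Set) → (G : Graph) → VSet G → Set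
HasPOn P G U = ∃ λ H → InducedIso H G U × P H

D1 : (G : Graph) → VSet G → VSet G
D1 G U x = ¬ U x × ∃ λ b → U b × Adj G x b

module Submission where

-- Suppose no vertex of D₁(B) is pendant.  Then every x ∈ D₁(B) has a neighbour
-- outside N[B]: a second neighbour inside N[B] would close a triangle or an ear of
-- length 2 or 3 on B, and an ear would put x into the block.  The set D₂ of such
-- neighbours is stable, since an edge inside D₂ closes a triangle, a 5-cycle or an
-- ear of length 5.  Extend D₂ by a maximal stable set T of the vertices outside
-- N[B] ∪ N[D₂]; then S = D₂ ∪ T is stable and N[S] is exactly the complement of B,
-- so B is the c-minor G ∖ N[S] and inherits P.  Membership in a block is decidable,
-- hence so is the existence of a pendant vertex in D₁(B), and refuting its absence
-- is enough.

open import Defs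
open import Data.Bool using (Bool; true; false)
import Data.Bool as Bool
open import Data.Empty using (⊥)
open import Data.Fin using (Fin; zero; suc; _≟_)
open import Data.Fin.Properties using (any?; all?)
open import Data.Fin.Subset using (Subset; inside; outside; _∈_; _∉_; _-_; _∪_; ⁅_⁆; ∣_∣)
  renaming (⊥ to ∅)
open import Data.Fin.Subset.Properties
  using (_∈?_; ∉⊥; x∈⁅y⁆⇒x≡y; x∈p∪q⁻; x∈p∪q⁺; x∈⁅x⁆; p─q⊆p; x∈p∧x≢y⇒x∈p-y; x∈p⇒∣p-x∣<∣p∣; anySubset?)
open import Data.List using (List; []; _∷_; length; filter; filterᵇ; allFin; lookup)
open import Data.List.Membership.Propositional using () renaming (_∈_ to _∈ˡ_)
open import Data.List.Membership.Propositional.Properties using (∈-allFin; ∈-filter⁺; ∈-filter⁻; ∈-lookup)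
open import Data.List.Relation.Unary.All as All using ([]; _∷_)
open import Data.List.Relation.Unary.AllPairs using ([]; _∷_)
open import Data.List.Relation.Unary.Any using (here; there; index)
open import Data.List.Relation.Unary.Any.Properties using (lookup-index)
open import Data.List.Relation.Unary.Unique.Propositional using (Unique)
open import Data.List.Relation.Unary.Unique.Propositional.Properties using (allFin⁺; filter⁺)
open import Data.Nat using (_≤_; suc)
import Data.Nat as ℕ
open import Data.Nat.Properties using (≤-refl; ≤-pred; <-≤-trans; n≮0)
open import Data.Product using (Σ; ∃; _×_; _,_; proj₁; proj₂)
open import Data.Sum using (_⊎_; inj₁; inj₂)
open import Data.Vec using ([]; _∷_; here; there)
open import Function using (_∘_)
open import Relation.Nullary using (¬_; Dec; yes; no; does; contradiction)
open import Relation.Nullary.Decidable using (map′; _×-dec_; _⊎-dec_; _→-dec_; ¬?; dec-true; decidable-stable; ¬¬-excluded-middle)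
open import Relation.Unary using (_⊆_; _≐_; Decidable)
open import Relation.Unary.Properties using (≐-sym)
open import Relation.Binary.PropositionalEquality as ≡ using (_≡_; _≢_; ≢-sym; refl; trans; cong)

∈∧∉⇒≢ : ∀ {A : Set} {P : A → Set} {u v} → P u → ¬ P v → u ≢ v
∈∧∉⇒≢ pu ¬pv refl = ¬pv pu

does-true⇒ : ∀ {A : Set} (a? : Dec A) → does a? ≡ true → A
does-true⇒ (yes a) _ = a

x∉p-x : ∀ {m} {p : Subset m} (x : Fin m) → x ∉ p - x
x∉p-x {p = _ ∷ _} zero ()
x∉p-x {p = _ ∷ _} (suc x) (there x∈p-x) = x∉p-x x x∈p-x

¬¬-subset : ∀ {m} (Q : Fin m → Set) → ¬ ¬ (∃ λ (p : Subset m) → (_∈ p) ≐ Q)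
¬¬-subset {ℕ.zero} Q k = k ([] , (λ ()) , λ { {()} })
¬¬-subset {suc m} Q k = ¬¬-excluded-middle λ Q0? → ¬¬-subset (Q ∘ suc) λ (p , p≐) → k (extend Q0? p p≐)
  where
  extend : Dec (Q zero) → (p : Subset m) → (_∈ p) ≐ (Q ∘ suc) → ∃ λ (p′ : Subset (suc m)) → (_∈ p′) ≐ Q
  extend (yes q) p (to , from) =
    inside ∷ p , (λ { here → q ; (there x∈p) → to x∈p }) , λ { {zero} _ → here ; {suc x} qx → there (from qx) }
  extend (no ¬q) p (to , from) =
    outside ∷ p , (λ { (there x∈p) → to x∈p }) , λ { {zero} q → contradiction q ¬q ; {suc x} qx → there (from qx) }

lookup-injective : ∀ {A : Set} {xs : List A} → Unique xs → ∀ i j → lookup xs i ≡ lookup xs j → i ≡ j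
lookup-injective {xs = _ ∷ _} _ zero zero _ = refl
lookup-injective {xs = _ ∷ _} (x∉xs ∷ _) zero (suc j) eq = contradiction eq (All.lookup x∉xs (∈-lookup j))
lookup-injective {xs = _ ∷ _} (x∉xs ∷ _) (suc i) zero eq = contradiction (≡.sym eq) (All.lookup x∉xs (∈-lookup i))
lookup-injective {xs = _ ∷ _} (_ ∷ uniq) (suc i) (suc j) eq = cong suc (lookup-injective uniq i j eq)

module _ {A : Set} (p : A → Bool) where

  length-filter-none : ∀ xs → (∀ {y} → y ∈ˡ xs → p y ≡ false) → length (filterᵇ p xs) ≡ 0
  length-filter-none [] _ = refl
  length-filter-none (x ∷ xs) none rewrite none (here refl) = length-filter-none xs (none ∘ there)

  length-filter-unique : ∀ {b} xs → Unique xs → b ∈ˡ xs → p b ≡ true → (∀ {y} → p y ≡ true → y ≡ b) →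
                         length (filterᵇ p xs) ≡ 1
  length-filter-unique (x ∷ xs) (x∉xs ∷ _) (here refl) pb only rewrite pb =
    cong suc (length-filter-none xs λ y∈xs → not-true λ py → All.lookup x∉xs y∈xs (≡.sym (only py)))
    where not-true : ∀ {c} → ¬ c ≡ true → c ≡ false
          not-true {true} ¬t = contradiction refl ¬t
          not-true {false} _ = refl
  length-filter-unique (x ∷ xs) (x∉xs ∷ uniq) (there b∈xs) pb only with p x in px
  ... | true = contradiction (only px) (λ { refl → All.lookup x∉xs b∈xs refl })
  ... | false = length-filter-unique xs uniq b∈xs pb only

module Walks (G : Graph) where

  Vertex : Set
  Vertex = Fin (n G)

  adj? : ∀ u v → Dec (Adj G u v)
  adj? u v = adj G u v Bool.≟ true

  adj-sym : ∀ {u v} → Adj G u v → Adj G v u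
  adj-sym {u} {v} = trans (sym G v u)

  adj⇒≢ : ∀ {u v} → Adj G u v → u ≢ v
  adj⇒≢ {u} u~u refl with trans (≡.sym (irrefl G u)) u~u
  ... | ()

  module _ {P : VSet G} where

    walk-source : ∀ {u v} → WalkIn G P u v → P u
    walk-source (here pu) = pu
    walk-source (step pu _ _) = pu

    walk-target : ∀ {u v} → WalkIn G P u v → P v
    walk-target (here pv) = pv
    walk-target (step _ _ w) = walk-target w

    _++ʷ_ : ∀ {u w v} → WalkIn G P u w → WalkIn G P w v → WalkIn G P u v
    here _ ++ʷ w′ = w′
    step pu u~x w ++ʷ w′ = step pu u~x (w ++ʷ w′)

    walk-snoc : ∀ {u w v} → WalkIn G P u w → Adj G w v → P v → WalkIn G P u v
    walk-snoc (here pw) w~v pv = step pw w~v (here pv)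
    walk-snoc (step pu u~x w) w~v pv = step pu u~x (walk-snoc w w~v pv)

    walk-reverse : ∀ {u v} → WalkIn G P u v → WalkIn G P v u
    walk-reverse (here pu) = here pu
    walk-reverse (step pu u~x w) = walk-snoc (walk-reverse w) (adj-sym u~x) pu

    walk-avoids-or-visits : ∀ {u v} x → WalkIn G P u v → WalkIn G (Remove G P x) u v ⊎ P x
    walk-avoids-or-visits {u} x (here pu) with u ≟ x
    ... | yes refl = inj₂ pu
    ... | no u≢x = inj₁ (here (pu , u≢x))
    walk-avoids-or-visits {u} x (step pu u~w w) with walk-avoids-or-visits x w | u ≟ x
    ... | inj₂ px | _ = inj₂ px
    ... | inj₁ _ | yes refl = inj₂ pu
    ... | inj₁ w′ | no u≢x = inj₁ (step (pu , u≢x) u~w w′)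

    -- Cut a walk at its last visit to u.
    walk-avoiding : ∀ {a v} u → u ≢ v → WalkIn G P a v →
      WalkIn G (Remove G P u) a v ⊎ ∃ λ w → Adj G u w × WalkIn G (Remove G P u) w v
    walk-avoiding u u≢v (here pv) = inj₁ (here (pv , ≢-sym u≢v))
    walk-avoiding {a} u u≢v (step pa a~w w) with walk-avoiding u u≢v w | a ≟ u
    ... | inj₂ suffix | _ = inj₂ suffix
    ... | inj₁ w′ | yes refl = inj₂ (_ , a~w , w′)
    ... | inj₁ w′ | no a≢u = inj₁ (step (pa , a≢u) a~w w′)

  walk-map : ∀ {P Q : VSet G} {u v} → P ⊆ Q → WalkIn G P u v → WalkIn G Q u v
  walk-map P⊆Q (here pu) = here (P⊆Q pu)
  walk-map P⊆Q (step pu u~w w) = step (P⊆Q pu) u~w (walk-map P⊆Q w)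

  connectedOn-cong : ∀ {P Q : VSet G} → P ≐ Q → ConnectedOn G P → ConnectedOn G Q
  connectedOn-cong (P⊆Q , Q⊆P) conn u v qu qv = walk-map P⊆Q (conn u v (Q⊆P qu) (Q⊆P qv))

  connNoCut-cong : ∀ {P Q : VSet G} → P ≐ Q → ConnNoCut G P → ConnNoCut G Q
  connNoCut-cong P≐Q@(P⊆Q , Q⊆P) (conn , cut) =
    connectedOn-cong P≐Q conn ,
    λ x qx → connectedOn-cong ((λ (pv , v≢x) → P⊆Q pv , v≢x) , (λ (qv , v≢x) → Q⊆P qv , v≢x)) (cut x (Q⊆P qx))

  connNoCut⇒connected-remove : ∀ {P : VSet G} → ConnNoCut G P → ∀ x → ConnectedOn G (Remove G P x)
  connNoCut⇒connected-remove (conn , cut) x u v (pu , u≢x) (pv , v≢x) with walk-avoids-or-visits x (conn u v pu pv)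
  ... | inj₁ avoiding = avoiding
  ... | inj₂ px = cut x px u v (pu , u≢x) (pv , v≢x)

  -- Two sets sharing two vertices cannot both lose both of them to one deleted vertex.
  ⋃-connNoCut : ∀ {I : Set} (W : I → VSet G) {a b} → a ≢ b →
    (∀ i → W i a × W i b × ConnNoCut G (W i)) → ConnNoCut G (λ v → ∃ λ i → W i v)
  ⋃-connNoCut W {a} {b} a≢b spans = connected , cut-free
    where
    into : ∀ i → W i ⊆ (λ v → ∃ λ j → W j v)
    into i wv = i , wv

    connected : ConnectedOn G (λ v → ∃ λ i → W i v)
    connected u v (i , u∈i) (j , v∈j) with spans i | spans j
    ... | a∈i , _ , (conn-i , _) | a∈j , _ , (conn-j , _) =
      walk-map (into i) (conn-i u a u∈i a∈i) ++ʷ walk-map (into j) (conn-j a v a∈j v∈j)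

    hub : ∀ x → ∃ λ h → h ≢ x × (∀ i → W i h)
    hub x with a ≟ x
    ... | yes refl = b , ≢-sym a≢b , λ i → proj₁ (proj₂ (spans i))
    ... | no a≢x = a , a≢x , λ i → proj₁ (spans i)

    cut-free : ∀ x → (∃ λ i → W i x) → ConnectedOn G (Remove G (λ v → ∃ λ i → W i v) x)
    cut-free x _ u v ((i , u∈i) , u≢x) ((j , v∈j) , v≢x) with hub x
    ... | h , h≢x , h∈ =
      walk-map (λ (w∈i , w≢x) → into i w∈i , w≢x)
        (connNoCut⇒connected-remove (proj₂ (proj₂ (spans i))) x u h (u∈i , u≢x) (h∈ i , h≢x)) ++ʷ
      walk-map (λ (w∈j , w≢x) → into j w∈j , w≢x)
        (connNoCut⇒connected-remove (proj₂ (proj₂ (spans j))) x h v (h∈ j , h≢x) (v∈j , v≢x))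

module Decidability (G : Graph) where
  open Walks G

  -- Recursion on |p|: a walk from u ≠ v leaves u through a neighbour and never returns.
  reachable? : ∀ (p : Subset (n G)) u v → Dec (WalkIn G (_∈ p) u v)
  reachable? p = within ∣ p ∣ p ≤-refl
    where
    within : ∀ k (p : Subset (n G)) → ∣ p ∣ ≤ k → ∀ u v → Dec (WalkIn G (_∈ p) u v)
    within ℕ.zero p ∣p∣≤0 u v = no λ w → n≮0 (<-≤-trans (x∈p⇒∣p-x∣<∣p∣ (walk-source w)) ∣p∣≤0)
    within (suc k) p ∣p∣≤1+k u v with u ∈? p | u ≟ v
    ... | no u∉p | _ = no (u∉p ∘ walk-source)
    ... | yes u∈p | yes refl = yes (here u∈p)
    ... | yes u∈p | no u≢v =
      map′ via-neighbour first-step (any? λ w → adj? u w ×-dec within k (p - u) ∣p-u∣≤k w v)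
      where
      ∣p-u∣≤k : ∣ p - u ∣ ≤ k
      ∣p-u∣≤k = ≤-pred (<-≤-trans (x∈p⇒∣p-x∣<∣p∣ u∈p) ∣p∣≤1+k)

      via-neighbour : (∃ λ w → Adj G u w × WalkIn G (_∈ p - u) w v) → WalkIn G (_∈ p) u v
      via-neighbour (w , u~w , rest) = step u∈p u~w (walk-map (p─q⊆p p ⁅ u ⁆) rest)

      first-step : WalkIn G (_∈ p) u v → ∃ λ w → Adj G u w × WalkIn G (_∈ p - u) w v
      first-step walk with walk-avoiding u u≢v walk
      ... | inj₁ avoiding = contradiction refl (proj₂ (walk-source avoiding))
      ... | inj₂ (w , u~w , rest) = w , u~w , walk-map (λ (x∈p , x≢u) → x∈p∧x≢y⇒x∈p-y x∈p x≢u) rest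

  connected? : ∀ (p : Subset (n G)) → Dec (ConnectedOn G (_∈ p))
  connected? p = all? λ u → all? λ v → (u ∈? p) →-dec ((v ∈? p) →-dec reachable? p u v)

  remove≐ : ∀ (p : Subset (n G)) x → (_∈ p - x) ≐ Remove G (_∈ p) x
  remove≐ p x = (λ v∈ → p─q⊆p p ⁅ x ⁆ v∈ , λ { refl → x∉p-x x v∈ }) , λ (v∈p , v≢x) → x∈p∧x≢y⇒x∈p-y v∈p v≢x

  connNoCut? : ∀ (p : Subset (n G)) → Dec (ConnNoCut G (_∈ p))
  connNoCut? p = connected? p ×-dec all? λ x → (x ∈? p) →-dec
    map′ (connectedOn-cong (remove≐ p x)) (connectedOn-cong (≐-sym (remove≐ p x))) (connected? (p - x))

  closedNbhd? : ∀ {S : VSet G} → Decidable S → Decidable (ClosedNbhd G S)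
  closedNbhd? S? v = S? v ⊎-dec any? λ u → S? u ×-dec adj? u v

  D1? : ∀ {B : VSet G} → Decidable B → Decidable (D1 G B)
  D1? B? x = ¬? (B? x) ×-dec any? λ b → B? b ×-dec adj? x b

  -- A block is the union U of all cut-vertex-free sets through two fixed vertices of it.
  -- Membership in U is decidable by enumerating subsets; B ⊆ U needs B to be a subset,
  -- which holds up to double negation, and that suffices since U is decidable.
  block? : ∀ {B : VSet G} → IsBlock G B → ∀ {a b} → B a → B b → a ≢ b → Decidable B
  block? {B} (B-connNoCut , maximal) {a} {b} Ba Bb a≢b v = map′ (U⊆B _) B⊆U (U? v)
    where
    Spanning : Set
    Spanning = Σ (Subset (n G)) λ p → a ∈ p × b ∈ p × ConnNoCut G (_∈ p)

    U : VSet G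
    U v = ∃ λ (s : Spanning) → v ∈ proj₁ s

    U? : Decidable U
    U? v = map′ (λ (p , a∈ , b∈ , c , v∈) → (p , a∈ , b∈ , c) , v∈) (λ ((p , a∈ , b∈ , c) , v∈) → p , a∈ , b∈ , c , v∈)
      (anySubset? λ p → (a ∈? p) ×-dec (b ∈? p) ×-dec connNoCut? p ×-dec (v ∈? p))


    B⊆U : B ⊆ U
    B⊆U {v} Bv = decidable-stable (U? v) λ ¬Uv → ¬¬-subset B λ (p , p≐B@(_ , B⊆p)) →
      ¬Uv ((p , B⊆p Ba , B⊆p Bb , connNoCut-cong (≐-sym p≐B) B-connNoCut) , B⊆p Bv)

    U⊆B : ∀ v → U v → B v
    U⊆B = maximal U (λ v Bv → B⊆U Bv) (⋃-connNoCut (λ s → _∈ proj₁ s) a≢b proj₂)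

module Ears (G : Graph) where
  open Walks G

  infixr 5 _∷_
  data Path : Vertex → Vertex → Set where
    end : ∀ {a} → Path a a
    _∷_ : ∀ {a b z} → Adj G a b → Path b z → Path a z

  vertices : ∀ {a z} → Path a z → List Vertex
  vertices {a} end = a ∷ []
  vertices {a} (_ ∷ p) = a ∷ vertices p

  source∈ : ∀ {a z} (p : Path a z) → a ∈ˡ vertices p
  source∈ end = here refl
  source∈ (_ ∷ _) = here refl

  OnPath : ∀ {a z} → Path a z → VSet G
  OnPath p = _∈ˡ vertices p

  path-prefix : ∀ {a z v} (p : Path a z) → OnPath p v → WalkIn G (OnPath p) a v
  path-prefix end (here refl) = here (here refl)
  path-prefix (_ ∷ _) (here refl) = here (here refl)
  path-prefix (a~b ∷ p) (there v∈p) = step (here refl) a~b (walk-map there (path-prefix p v∈p))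

  path-suffix : ∀ {a z v} (p : Path a z) → OnPath p v → WalkIn G (OnPath p) v z
  path-suffix end (here refl) = here (here refl)
  path-suffix (a~b ∷ p) (here refl) = step (here refl) a~b (walk-map there (path-suffix p (source∈ p)))
  path-suffix (a~b ∷ p) (there v∈p) = walk-map there (path-suffix p v∈p)

  -- A vertex x occurs at most once on a path, so it blocks only one of the two directions.
  path-split : ∀ {a z v x} (p : Path a z) → Unique (vertices p) → OnPath p v → v ≢ x →
    WalkIn G (Remove G (OnPath p) x) v a ⊎ WalkIn G (Remove G (OnPath p) x) v z
  path-split end _ (here refl) v≢x = inj₁ (here (here refl , v≢x))
  path-split (_ ∷ _) _ (here refl) v≢x = inj₁ (here (here refl , v≢x))
  path-split {a} {x = x} (a~b ∷ p) (a∉p ∷ uniq) (there v∈p) v≢x with path-split p uniq v∈p v≢x | a ≟ x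
  ... | inj₂ to-target | _ = inj₂ (walk-map (λ (w∈p , w≢x) → there w∈p , w≢x) to-target)
  ... | inj₁ _ | yes refl = inj₂ (walk-map (λ w∈p → there w∈p , λ { refl → All.lookup a∉p w∈p refl }) (path-suffix p v∈p))
  ... | inj₁ to-b | no a≢x =
    inj₁ (walk-snoc (walk-map (λ (w∈p , w≢x) → there w∈p , w≢x) to-b) (adj-sym a~b) (here refl , a≢x))

  -- B together with an ear still has no cut vertex, so the maximal B absorbs the ear.
  ear⊆block : ∀ {B : VSet G} → IsBlock G B → ∀ {a z} (p : Path a z) → Unique (vertices p) →
    B a → B z → a ≢ z → OnPath p ⊆ B
  ear⊆block {B} (B-connNoCut@(B-connected , _) , maximal) {a} {z} p uniq Ba Bz a≢z {v} v∈p =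
    maximal Ear (λ _ → inj₁) (connected , cut-free) v (inj₂ v∈p)
    where
    Ear : VSet G
    Ear v = B v ⊎ OnPath p v

    to-source : ∀ u → Ear u → WalkIn G Ear u a
    to-source u (inj₁ Bu) = walk-map inj₁ (B-connected u a Bu Ba)
    to-source u (inj₂ u∈p) = walk-map inj₂ (walk-reverse (path-prefix p u∈p))

    connected : ConnectedOn G Ear
    connected u v eu ev = to-source u eu ++ʷ walk-reverse (to-source v ev)

    within-B : ∀ {u h} x → B u → u ≢ x → B h → h ≢ x → WalkIn G (Remove G Ear x) u h
    within-B x Bu u≢x Bh h≢x =
      walk-map (λ (Bw , w≢x) → inj₁ Bw , w≢x) (connNoCut⇒connected-remove B-connNoCut x _ _ (Bu , u≢x) (Bh , h≢x))

    widen : ∀ {x s t} → WalkIn G (Remove G (OnPath p) x) s t → WalkIn G (Remove G Ear x) s t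
    widen = walk-map λ (w∈p , w≢x) → inj₂ w∈p , w≢x

    route : ∀ {u h} x → Ear u → u ≢ x → B h → h ≢ x → WalkIn G (Remove G Ear x) u h
    route x (inj₁ Bu) u≢x Bh h≢x = within-B x Bu u≢x Bh h≢x
    route x (inj₂ u∈p) u≢x Bh h≢x with path-split p uniq u∈p u≢x
    ... | inj₁ to-a = widen to-a ++ʷ within-B x Ba (proj₂ (walk-target to-a)) Bh h≢x
    ... | inj₂ to-z = widen to-z ++ʷ within-B x Bz (proj₂ (walk-target to-z)) Bh h≢x

    cut-free : ∀ x → Ear x → ConnectedOn G (Remove G Ear x)
    cut-free x _ u v (eu , u≢x) (ev , v≢x) with a ≟ x
    ... | yes refl = route x eu u≢x Bz (≢-sym a≢z) ++ʷ walk-reverse (route x ev v≢x Bz (≢-sym a≢z))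
    ... | no a≢x = route x eu u≢x Ba a≢x ++ʷ walk-reverse (route x ev v≢x Ba a≢x)

module Neighbourhoods (G : Graph) where
  open Walks G

  deg≡1 : ∀ {x b} → Adj G x b → (∀ {y} → Adj G x y → y ≡ b) → deg G x ≡ 1
  deg≡1 x~b only = length-filter-unique (adj G _) (allFin (n G)) (allFin⁺ (n G)) (∈-allFin _) x~b only

  second-neighbour : ∀ {x b} → Adj G x b → deg G x ≢ 1 → ∃ λ y → Adj G x y × y ≢ b
  second-neighbour {x} {b} x~b deg≢1 with any? (λ y → adj? x y ×-dec ¬? (y ≟ b))
  ... | yes found = found
  ... | no none = contradiction (deg≡1 x~b λ {y} x~y → decidable-stable (y ≟ b) λ y≢b → none (y , x~y , y≢b)) deg≢1

  closedNbhd-mono : ∀ {S S′ : VSet G} → S ⊆ S′ → ClosedNbhd G S ⊆ ClosedNbhd G S′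
  closedNbhd-mono S⊆S′ (inj₁ v∈S) = inj₁ (S⊆S′ v∈S)
  closedNbhd-mono S⊆S′ (inj₂ (u , u∈S , u~v)) = inj₂ (u , S⊆S′ u∈S , u~v)

  induced : (U : VSet G) → Decidable U → ∃ λ H → InducedIso H G U
  induced U U? = H , embed , lookup-injective (filter⁺ U? (allFin⁺ (n G))) , embed∈U , onto , λ _ _ → refl
    where
    members : List Vertex
    members = filter U? (allFin (n G))

    embed : Fin (length members) → Vertex
    embed = lookup members

    H : Graph
    H = record { n = length members ; adj = λ i j → adj G (embed i) (embed j)
               ; sym = λ i j → sym G (embed i) (embed j) ; irrefl = λ i → irrefl G (embed i) }

    embed∈U : ∀ i → U (embed i)
    embed∈U i = proj₂ (∈-filter⁻ U? {xs = allFin (n G)} (∈-lookup i))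

    onto : ∀ v → U v → ∃ λ i → embed i ≡ v
    onto v Uv = let v∈members = ∈-filter⁺ U? (∈-allFin v) Uv in index v∈members , ≡.sym (lookup-index v∈members)

  inducedIso-cong : ∀ {H} {U U′ : VSet G} → U ≐ U′ → InducedIso H G U → InducedIso H G U′
  inducedIso-cong (U⊆U′ , U′⊆U) (f , injective , into , onto , preserves) =
    f , injective , U⊆U′ ∘ into , (λ v → onto v ∘ U′⊆U) , preserves

  -- The c-minor is defined through a Boolean stable set, so the predicate is replaced by its decision.
  stable⇒cMinor : ∀ {H} (S : VSet G) → Decidable S → Stable G S →
    InducedIso H G (λ v → ¬ ClosedNbhd G S v) → IsCMinor H G
  stable⇒cMinor {H} S S? stable iso =
    (λ v → does (S? v)) , (λ u v u∈ v∈ → stable u v (chosen⇒S u∈) (chosen⇒S v∈)) ,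
    inducedIso-cong {H} ((λ ¬N → ¬N ∘ closedNbhd-mono chosen⇒S) , (λ ¬N → ¬N ∘ closedNbhd-mono S⇒chosen)) iso
    where
    chosen⇒S : (λ v → does (S? v) ≡ true) ⊆ S
    chosen⇒S {v} = does-true⇒ (S? v)

    S⇒chosen : S ⊆ (λ v → does (S? v) ≡ true)
    S⇒chosen {v} = dec-true (S? v)

  record MaximalStableIn (R : VSet G) : Set where
    field
      members : Subset (n G)
      members⊆ : (_∈ members) ⊆ R
      stable : Stable G (_∈ members)
      dominates : R ⊆ ClosedNbhd G (_∈ members)

  maximal-stable : ∀ {R : VSet G} → Decidable R → MaximalStableIn R
  maximal-stable {R} R? =
    let t , t⊆R , stable , dominates = greedy (allFin (n G))
    in record { members = t ; members⊆ = t⊆R ; stable = stable ; dominates = dominates (∈-allFin _) }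
    where
    StableDominating : List Vertex → Set
    StableDominating xs =
      ∃ λ t → (_∈ t) ⊆ R × Stable G (_∈ t) × (∀ {v} → v ∈ˡ xs → R v → ClosedNbhd G (_∈ t) v)

    insert : ∀ x {xs} → StableDominating xs → StableDominating (x ∷ xs)
    insert x (t , t⊆R , stable , dominates) with R? x | any? (λ u → (u ∈? t) ×-dec adj? u x)
    ... | no ¬Rx | _ =
      t , t⊆R , stable , λ { (here refl) Rx → contradiction Rx ¬Rx ; (there v∈xs) → dominates v∈xs }
    ... | yes _ | yes x-dominated =
      t , t⊆R , stable , λ { (here refl) _ → inj₂ x-dominated ; (there v∈xs) → dominates v∈xs }
    ... | yes Rx | no ¬x-dominated = t ∪ ⁅ x ⁆ , t′⊆R , stable′ , dominates′
      where
      t′-cases : ∀ {v} → v ∈ t ∪ ⁅ x ⁆ → v ∈ t ⊎ v ≡ x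
      t′-cases {v} v∈ with x∈p∪q⁻ t ⁅ x ⁆ v∈
      ... | inj₁ v∈t = inj₁ v∈t
      ... | inj₂ v∈x = inj₂ (x∈⁅y⁆⇒x≡y x v∈x)

      t′⊆R : (_∈ t ∪ ⁅ x ⁆) ⊆ R
      t′⊆R v∈ with t′-cases v∈
      ... | inj₁ v∈t = t⊆R v∈t
      ... | inj₂ refl = Rx

      stable′ : Stable G (_∈ t ∪ ⁅ x ⁆)
      stable′ u v u∈ v∈ u~v with t′-cases u∈ | t′-cases v∈
      ... | inj₁ u∈t | inj₁ v∈t = stable u v u∈t v∈t u~v
      ... | inj₁ u∈t | inj₂ refl = ¬x-dominated (u , u∈t , u~v)
      ... | inj₂ refl | inj₁ v∈t = ¬x-dominated (v , v∈t , adj-sym u~v)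
      ... | inj₂ refl | inj₂ refl = adj⇒≢ u~v refl

      dominates′ : ∀ {v} → v ∈ˡ x ∷ _ → R v → ClosedNbhd G (_∈ t ∪ ⁅ x ⁆) v
      dominates′ (here refl) _ = inj₁ (x∈p∪q⁺ (inj₂ (x∈⁅x⁆ x)))
      dominates′ (there v∈xs) Rv = closedNbhd-mono (x∈p∪q⁺ ∘ inj₁) (dominates v∈xs Rv)

    greedy : ∀ xs → StableDominating xs
    greedy [] = ∅ , (λ v∈∅ → contradiction v∈∅ ∉⊥) , (λ _ _ u∈∅ → contradiction u∈∅ ∉⊥) , λ ()
    greedy (x ∷ xs) = insert x (greedy xs)

module PendantFree (G : Graph) (noC3 : ¬ HasC3 G) (noC5 : ¬ HasC5 G)
    {B : VSet G} (block : IsBlock G B) (B? : Decidable B)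
    (no-pendant : ∀ {x} → D1 G B x → deg G x ≢ 1) where
  open Walks G
  open Decidability G
  open Ears G
  open Neighbourhoods G

  N[B] : VSet G
  N[B] = ClosedNbhd G B

  B⊆N[B] : B ⊆ N[B]
  B⊆N[B] = inj₁

  D1⊆N[B] : D1 G B ⊆ N[B]
  D1⊆N[B] (_ , b , Bb , x~b) = inj₂ (b , Bb , adj-sym x~b)

  far-neighbour : ∀ {x} → D1 G B x → ∃ λ y → Adj G x y × ¬ N[B] y
  far-neighbour {x} x∈D1@(x∉B , b , Bb , x~b) with second-neighbour x~b (no-pendant x∈D1)
  ... | y , x~y , y≢b = y , x~y , y∉N[B]
    where
    b≢x : b ≢ x
    b≢x = ∈∧∉⇒≢ Bb x∉B

    y∉N[B] : ¬ N[B] y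
    y∉N[B] (inj₁ By) =
      x∉B (ear⊆block block (adj-sym x~b ∷ x~y ∷ end)
            ((b≢x ∷ ≢-sym y≢b ∷ []) ∷ (adj⇒≢ x~y ∷ []) ∷ [] ∷ [])
            Bb By (≢-sym y≢b) (there (here refl)))
    y∉N[B] (inj₂ (b′ , Bb′ , b′~y)) with b′ ≟ b
    ... | yes refl = noC3 (x , b′ , y , ≢-sym b≢x , adj⇒≢ x~y , ≢-sym y≢b , x~b , b′~y , adj-sym x~y)
    ... | no b′≢b =
      x∉B (ear⊆block block (adj-sym x~b ∷ x~y ∷ adj-sym b′~y ∷ end)
            ((b≢x ∷ ≢-sym y≢b ∷ ≢-sym b′≢b ∷ []) ∷ (adj⇒≢ x~y ∷ ≢-sym (∈∧∉⇒≢ Bb′ x∉B) ∷ []) ∷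
             (≢-sym (adj⇒≢ b′~y) ∷ []) ∷ [] ∷ [])
            Bb Bb′ (≢-sym b′≢b) (there (here refl)))

  D2 : VSet G
  D2 v = ¬ N[B] v × ∃ λ x → D1 G B x × Adj G x v

  D2? : Decidable D2
  D2? v = ¬? (closedNbhd? B? v) ×-dec any? (λ x → D1? B? x ×-dec adj? x v)

  D2-stable : Stable G D2
  D2-stable y y′ (y∉N , x , x∈D1@(x∉B , b , Bb , x~b) , x~y)
                 (y′∉N , x′ , x′∈D1@(x′∉B , b′ , Bb′ , x′~b′) , x′~y′) y~y′ =
    by-cases (x ≟ x′) (b ≟ b′)
    where
    b≢x : b ≢ x
    b≢x = ∈∧∉⇒≢ Bb x∉B
    b≢y : b ≢ y
    b≢y = ∈∧∉⇒≢ (B⊆N[B] Bb) y∉N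
    b≢y′ : b ≢ y′
    b≢y′ = ∈∧∉⇒≢ (B⊆N[B] Bb) y′∉N
    b≢x′ : b ≢ x′
    b≢x′ = ∈∧∉⇒≢ Bb x′∉B
    x≢y : x ≢ y
    x≢y = adj⇒≢ x~y
    x≢y′ : x ≢ y′
    x≢y′ = ∈∧∉⇒≢ (D1⊆N[B] x∈D1) y′∉N
    y≢y′ : y ≢ y′
    y≢y′ = adj⇒≢ y~y′
    y≢x′ : y ≢ x′
    y≢x′ = ≢-sym (∈∧∉⇒≢ (D1⊆N[B] x′∈D1) y∉N)
    y′≢x′ : y′ ≢ x′
    y′≢x′ = ≢-sym (adj⇒≢ x′~y′)

    by-cases : Dec (x ≡ x′) → Dec (b ≡ b′) → ⊥
    by-cases (yes refl) _ = noC3 (x , y , y′ , x≢y , ≢-sym y′≢x′ , y≢y′ , x~y , y~y′ , adj-sym x′~y′)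
    by-cases (no x≢x′) (yes refl) =
      noC5 (b , x , y , y′ , x′ ,
            (b≢x , b≢y , b≢y′ , b≢x′ , x≢y , x≢y′ , x≢x′ , y≢y′ , y≢x′ , y′≢x′) ,
            adj-sym x~b , x~y , y~y′ , adj-sym x′~y′ , x′~b′)
    by-cases (no x≢x′) (no b≢b′) =
      x∉B (ear⊆block block (adj-sym x~b ∷ x~y ∷ y~y′ ∷ adj-sym x′~y′ ∷ x′~b′ ∷ end)
            ((b≢x ∷ b≢y ∷ b≢y′ ∷ b≢x′ ∷ b≢b′ ∷ []) ∷
             (x≢y ∷ x≢y′ ∷ x≢x′ ∷ ≢-sym (∈∧∉⇒≢ Bb′ x∉B) ∷ []) ∷
             (y≢y′ ∷ y≢x′ ∷ ≢-sym (∈∧∉⇒≢ (B⊆N[B] Bb′) y∉N) ∷ []) ∷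
             (y′≢x′ ∷ ≢-sym (∈∧∉⇒≢ (B⊆N[B] Bb′) y′∉N) ∷ []) ∷
             (≢-sym (∈∧∉⇒≢ Bb′ x′∉B) ∷ []) ∷ [] ∷ [])
            Bb Bb′ b≢b′ (there (here refl)))

  Rest : VSet G
  Rest v = ¬ N[B] v × ¬ ClosedNbhd G D2 v

  open MaximalStableIn (maximal-stable {Rest} λ v → ¬? (closedNbhd? B? v) ×-dec ¬? (closedNbhd? D2? v))
    renaming (members to T; members⊆ to T⊆Rest; stable to T-stable; dominates to T-dominates)

  Chosen : VSet G
  Chosen v = D2 v ⊎ v ∈ T

  Chosen? : Decidable Chosen
  Chosen? v = D2? v ⊎-dec (v ∈? T)

  Chosen⇒∉N[B] : ∀ {v} → Chosen v → ¬ N[B] v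
  Chosen⇒∉N[B] (inj₁ (v∉N , _)) = v∉N
  Chosen⇒∉N[B] (inj₂ v∈T) = proj₁ (T⊆Rest v∈T)

  Chosen-stable : Stable G Chosen
  Chosen-stable u v (inj₁ u∈D2) (inj₁ v∈D2) = D2-stable u v u∈D2 v∈D2
  Chosen-stable u v (inj₁ u∈D2) (inj₂ v∈T) u~v = proj₂ (T⊆Rest v∈T) (inj₂ (u , u∈D2 , u~v))
  Chosen-stable u v (inj₂ u∈T) (inj₁ v∈D2) u~v = proj₂ (T⊆Rest u∈T) (inj₂ (v , v∈D2 , adj-sym u~v))
  Chosen-stable u v (inj₂ u∈T) (inj₂ v∈T) = T-stable u v u∈T v∈T

  outside-B-covered : ∀ {v} → ¬ B v → ClosedNbhd G Chosen v
  outside-B-covered {v} v∉B with closedNbhd? B? v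
  ... | yes (inj₁ Bv) = contradiction Bv v∉B
  ... | yes (inj₂ (b , Bb , b~v)) =
    let v∈D1 = v∉B , b , Bb , adj-sym b~v
        (y , v~y , y∉N) = far-neighbour v∈D1
    in inj₂ (y , inj₁ (y∉N , v , v∈D1 , v~y) , adj-sym v~y)
  ... | no v∉N with closedNbhd? D2? v
  ...   | yes v∈N[D2] = closedNbhd-mono inj₁ v∈N[D2]
  ...   | no v∉N[D2] = closedNbhd-mono inj₂ (T-dominates (v∉N , v∉N[D2]))

  uncovered≐B : (λ v → ¬ ClosedNbhd G Chosen v) ≐ B
  uncovered≐B = (λ {v} uncovered → decidable-stable (B? v) (uncovered ∘ outside-B-covered)) , covered⇒∉B
    where
    covered⇒∉B : ∀ {v} → B v → ¬ ClosedNbhd G Chosen v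
    covered⇒∉B Bv (inj₁ v∈Chosen) = Chosen⇒∉N[B] v∈Chosen (B⊆N[B] Bv)
    covered⇒∉B Bv (inj₂ (u , u∈Chosen , u~v)) = Chosen⇒∉N[B] u∈Chosen (inj₂ (_ , Bv , adj-sym u~v))

  block-cMinor : ∀ {H} → InducedIso H G B → IsCMinor H G
  block-cMinor {H} iso =
    stable⇒cMinor {H} Chosen Chosen? Chosen-stable (inducedIso-cong {H} (≐-sym uncovered≐B) iso)

mainTheorem11 : (P : Graph → Set) → ClosedUnderCMinors P →
    (G : Graph) → ¬ HasC3 G → ¬ HasC5 G →
    (B : VSet G) → IsBlock G B → TwoConnected G B →
    P G → ¬ HasPOn P G B →
    ∃ λ x → D1 G B x × deg G x ≡ 1
-- 2-connectedness is used only for two distinct vertices of B, which make B decidable.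
mainTheorem11 P closed G noC3 noC5 B block ((a , b , _ , Ba , Bb , _ , a≢b , _) , _) PG ¬PB =
  decidable-stable (any? λ x → D1? B? x ×-dec (deg G x ℕ.≟ 1)) λ no-pendant →
    let (H , H≅B) = induced B B?
        pendant-free = λ {x} x∈D1 deg≡1 → no-pendant (x , x∈D1 , deg≡1)
    in ¬PB (H , H≅B , closed G H (PendantFree.block-cMinor G noC3 noC5 block B? pendant-free {H} H≅B) PG)
  where
  open Decidability G
  open Neighbourhoods G

  B? : Decidable B
  B? = block? block Ba Bb a≢b
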